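{- Let $k$ be a positive integer, let $\pi$ be a set partition of $[k]$, and let $\langle\mathfrak{S}_k,e_\pi\rangle$ be the submonoid of $\mathcal{U}_k$ generated by $\mathfrak{S}_k$ and $e_\pi$. Then: (1) for every set partition $\gamma$ of $[k]$ with $\mathrm{type}(\gamma)\neq 1^k$, we have $e_\gamma\in\langle\mathfrak{S}_k,e_\pi\rangle$ if and only if $\mathrm{type}(\gamma)\preceq\mathrm{type}(\pi)$; (2) $\langle\mathfrak{S}_k,e_\pi\rangle=\mathfrak{S}_k\cup\bigcup_{\mu\preceq\mathrm{type}(\pi)}J_\mu$.
   Context: Let $[k]=\{1,\dots,k\}$, $[\bar k]=\{\bar 1,\dots,\bar k\}$. $\mathcal{U}_k$ is the set of set partitions of $[k]\cup[\bar k]$ all of whose blocks $A$ satisfy $|A\cap[k]|=|A\cap[\bar k]|$, with product given by diagram concatenation: for $\pi,\gamma\in\mathcal{U}_k$, place $\pi$ on $[k]\cup M$ (renaming $\bar i$ to $i'$) and $\gamma$ on $M\cup[\bar k]$ (renaming $i$ to $i'$), $M=\{1',\dots,k'\}$, take the join (connected components) of these two set partitions of $[k]\cup M\cup[\bar k]$, and restrict to $[k]\cup[\bar k]$. A permutation $\sigma\in\mathfrak{S}_k$ is identified with $\{\{\sigma(i),\bar i\}:i\in[k]\}$. For a set partition $\rho$ of $[k]$, $e_\rho\in\mathcal{U}_k$ is the idempotent with blocks $A\cup\{\bar a: a\in A\}$ for $A\in\rho$. The type of a set partition of $[k]$ is the sorted list of block sizes; the type of $\pi\in\mathcal{U}_k$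 is the sorted list of sizes $|A\cap[k]|$, $A\in\pi$. $J_\mu=\{x\in\mathcal{U}_k:\text{type}(x)=\mu\}$. For set partitions of $[k]$, $\vee$ is the join in refinement order; for integer partitions $\mu,\lambda$ of $k$, $\mu\preceq\lambda$ means there exist $\ell\ge0$ and set partitions $\pi_0,\dots,\pi_\ell$ of $[k]$ of type $\lambda$ whose join has type $\mu$. -}

module Defs where

open import Data.Nat using (ℕ; suc; _≟_)
open import Data.Fin using (Fin; toℕ)
open import Data.Sum using (_⊎_; inj₁; inj₂)
open import Data.Product using (Σ; ∃; _×_; _,_)
open import Data.List using (List; map; _++_; length; filter; allFin; deduplicate; replicate)
open import Data.List.Relation.Binary.Permutation.Propositional using (_↭_)
open import Data.Fin.Permutation using (Permutation′; _⟨$⟩ˡ_)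
open import Relation.Binary.PropositionalEquality using (_≡_)
open import Relation.Binary.Construct.Closure.ReflexiveTransitive using (Star)
open import Function.Bundles using (_⇔_)

-- Set partitions are encoded by labelings: a function f : X → ℕ encodes
-- the set partition of X whose blocks are the nonempty fibres of f
-- (x, y in the same block iff f x ≡ f y).  Two labelings encode the same
-- set partition iff they have the same kernel (SameKer).

SameKer : {X : Set} → (X → ℕ) → (X → ℕ) → Set
SameKer {X} f g = (x y : X) → (f x ≡ f y) ⇔ (g x ≡ g y)

SetPart : ℕ → Set
SetPart k = Fin k → ℕ

-- Points of [k] ∪ [k̄]: inj₁ i is i, inj₂ i is ī.
Pt : ℕ → Set
Pt k = Fin k ⊎ Fin k

Diagram : ℕ → Set
Diagram k = Pt k → ℕ

allPt : (k : ℕ) → List (Pt k)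
allPt k = map inj₁ (allFin k) ++ map inj₂ (allFin k)

countTop : {k : ℕ} → Diagram k → ℕ → ℕ
countTop {k} f l = length (filter (λ i → f (inj₁ i) ≟ l) (allFin k))

countBot : {k : ℕ} → Diagram k → ℕ → ℕ
countBot {k} f l = length (filter (λ i → f (inj₂ i) ≟ l) (allFin k))

InU : {k : ℕ} → Diagram k → Set
InU f = (l : ℕ) → countTop f l ≡ countBot f l

-- Types (as lists of block sizes; compared up to permutation _↭_,
-- i.e. as multisets, which is the same as comparing sorted lists).

typeSP : {k : ℕ} → SetPart k → List ℕ
typeSP {k} g =
  map (λ l → length (filter (λ i → g i ≟ l) (allFin k)))
      (deduplicate _≟_ (map g (allFin k)))

typeD : {k : ℕ} → Diagram k → List ℕ
typeD {k} f = map (countTop f) (deduplicate _≟_ (map f (allPt k)))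

-- Diagram product.  Points of [k] ∪ M ∪ [k̄]:
-- inj₁ i = i, inj₂ (inj₁ i) = i', inj₂ (inj₂ i) = ī.

Pt3 : ℕ → Set
Pt3 k = Fin k ⊎ (Fin k ⊎ Fin k)

-- π placed on [k] ∪ M (ī renamed to i')
onUpper : {k : ℕ} → Pt3 k → Pt k → Set
onUpper (inj₁ i) p = p ≡ inj₁ i
onUpper (inj₂ (inj₁ i)) p = p ≡ inj₂ i
onUpper (inj₂ (inj₂ i)) p = Data.Empty.⊥
  where import Data.Empty

-- γ placed on M ∪ [k̄] (i renamed to i')
onLower : {k : ℕ} → Pt3 k → Pt k → Set
onLower (inj₁ i) p = Data.Empty.⊥
  where import Data.Empty
onLower (inj₂ (inj₁ i)) p = p ≡ inj₁ i
onLower (inj₂ (inj₂ i)) p = p ≡ inj₂ i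

ProdEdge : {k : ℕ} → Diagram k → Diagram k → Pt3 k → Pt3 k → Set
ProdEdge {k} π γ a b =
  (Σ (Pt k) λ p → Σ (Pt k) λ q → onUpper a p × onUpper b q × π p ≡ π q)
  ⊎ (Σ (Pt k) λ p → Σ (Pt k) λ q → onLower a p × onLower b q × γ p ≡ γ q)

embed : {k : ℕ} → Pt k → Pt3 k
embed (inj₁ i) = inj₁ i
embed (inj₂ i) = inj₂ (inj₂ i)

-- z represents the product π γ: the join of the two set partitions of
-- [k] ∪ M ∪ [k̄] (connected components, i.e. reflexive–transitive closure
-- of the union), restricted to [k] ∪ [k̄].
IsProduct : {k : ℕ} → Diagram k → Diagram k → Diagram k → Set
IsProduct {k} π γ z =
  (a b : Pt k) → (z a ≡ z b) ⇔ Star (ProdEdge π γ) (embed a) (embed b)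

-- σ ↦ {{σ(i), ī} : i ∈ [k]}: top point j is labelled σ⁻¹(j), bottom ī by i
permDiagram : {k : ℕ} → Permutation′ k → Diagram k
permDiagram σ (inj₁ j) = toℕ (σ ⟨$⟩ˡ j)
permDiagram σ (inj₂ i) = toℕ i

IsPerm : {k : ℕ} → Diagram k → Set
IsPerm {k} x = Σ (Permutation′ k) λ σ → SameKer x (permDiagram σ)

eDiag : {k : ℕ} → SetPart k → Diagram k
eDiag ρ (inj₁ i) = ρ i
eDiag ρ (inj₂ i) = ρ i

-- membership in the submonoid ⟨𝔖_k, e_π⟩ of U_k (closure of the generators
-- under the diagram product; the identity is the identity permutation)
data InGen {k : ℕ} (π : SetPart k) : Diagram k → Set where
  gen-perm : {x : Diagram k} → IsPerm x → InGen π x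
  gen-e    : {x : Diagram k} → SameKer x (eDiag π) → InGen π x
  gen-mul  : {x y z : Diagram k} → InGen π x → InGen π y → IsProduct x y z → InGen π z

JoinEdge : {k ℓ : ℕ} → (Fin ℓ → SetPart k) → Fin k → Fin k → Set
JoinEdge {ℓ = ℓ} ps a b = Σ (Fin ℓ) λ j → ps j a ≡ ps j b

Preceq : (k : ℕ) → List ℕ → List ℕ → Set
Preceq k μ λ′ =
  Σ ℕ λ ℓ → Σ (Fin (suc ℓ) → SetPart k) λ ps →
    ((j : Fin (suc ℓ)) → typeSP (ps j) ↭ λ′) ×
    Σ (SetPart k) λ h →
      ((a b : Fin k) → (h a ≡ h b) ⇔ Star (JoinEdge ps) a b) ×
      typeSP h ↭ μ

oneK : ℕ → List ℕ
oneK k = replicate k 1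

-- Every element x of U_k is, up to the names of its blocks, a diagram
-- `diagram ρ α`: the top point i and the bottom point ȷ̄ share a block iff
-- ρ i = ρ (α j), where ρ is the set partition of the top row and the
-- permutation α matches the points of the two rows block by block (possible
-- because every block is balanced).  The product of `diagram ρ α` and
-- `diagram ρ′ β` is `diagram (J ∘ α⁻¹) (α ∘ β)`, where J is the join of
-- ρ ∘ α and ρ′ on the middle row.  By induction, every element of
-- ⟨𝔖_k, e_π⟩ is `diagram ρ α` with ρ the join of finitely many set
-- partitions of type(π): the empty join gives a permutation, a nonempty one
-- gives type(x) = type(ρ) ⪯ type(π).  Conversely, conjugating e_π by
-- permutations gives e_ρ for every ρ of type(π), products of these give e_J
-- for every join J of them, and multiplying e_J by permutations on both
-- sides gives every x of type type(J).

module Submission where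

open import Defs
open import Level using (0ℓ)
open import Data.Nat using (ℕ; zero; suc; _≟_; _≤_)
import Data.Nat.Properties as ℕ
open import Data.Fin using (Fin; zero; suc; toℕ; punchIn; punchOut)
import Data.Fin.Properties as Fin
open import Data.Fin.Permutation using (Permutation′; _⟨$⟩ˡ_; _⟨$⟩ʳ_; insert; inverseˡ; inverseʳ; _∘ₚ_)
import Data.Fin.Permutation as Perm
open import Data.Sum using (_⊎_; inj₁; inj₂)
open import Data.Product using (Σ; ∃; _×_; _,_; proj₁; proj₂)
open import Data.Empty using (⊥-elim)
open import Data.List using (List; []; _∷_; map; tabulate; _++_; length; filter; allFin; deduplicate; replicate; lookup; cartesianProduct)
import Data.List.Properties as List
open import Data.List.Relation.Unary.Any using (Any; here; there; any?)
import Data.List.Relation.Unary.Any as Any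
import Data.List.Relation.Unary.Any.Properties as Any
open import Data.List.Relation.Unary.All using (All; []; _∷_)
import Data.List.Relation.Unary.All as All
import Data.List.Relation.Unary.All.Properties as All
open import Data.List.Relation.Unary.AllPairs using ([]; _∷_)
open import Data.List.Relation.Unary.Unique.Propositional using (Unique)
import Data.List.Relation.Unary.Unique.Propositional.Properties as Unique
open import Data.List.Relation.Unary.Unique.DecPropositional.Properties _≟_ using (deduplicate-!)
open import Data.List.Membership.Propositional using (_∈_; find; lose)
open import Data.List.Membership.Propositional.Properties
open import Data.List.Membership.Propositional.Properties.WithK using (unique∧set⇒bag)
open import Data.List.Membership.DecPropositional _≟_ using (_∈?_)
open import Data.List.Relation.Binary.BagAndSetEquality using (∼bag⇒↭)
open import Data.List.Relation.Binary.Permutation.Propositional using (_↭_; ↭-refl; ↭-sym; ↭-trans; ↭-prep; ↭-reflexive; ↭⇒↭ₛ)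
open import Data.List.Relation.Binary.Permutation.Propositional.Properties
open import Relation.Nullary using (¬_; Dec; yes; no)
open import Relation.Binary.Core using (Rel; _⇒_)
open import Relation.Binary.Definitions using (Symmetric; Decidable)
open import Relation.Binary.Structures using (IsEquivalence)
open import Relation.Binary.PropositionalEquality
open import Data.List.Relation.Binary.Permutation.Setoid.Properties (setoid ℕ) using (Unique-resp-↭)
open import Relation.Binary.Construct.Union using (_∪_)
open import Relation.Binary.Construct.Closure.ReflexiveTransitive using (Star; ε; _◅_; _◅◅_; gmap; fold; kleisliStar; return; reverse)
import Relation.Binary.Construct.Closure.ReflexiveTransitive as Star
open import Function using (_∘_; id; _on_)
open import Function.Definitions using (Injective)
open import Function.Bundles using (_⇔_; mk⇔; Equivalence)
open import Function.Properties.Equivalence using (⇔-isEquivalence)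

module ⇔ = IsEquivalence (⇔-isEquivalence {0ℓ})
open Equivalence using (to; from)

⟨$⟩ʳ-injective : ∀ {n} (σ : Permutation′ n) → Injective _≡_ _≡_ (σ ⟨$⟩ʳ_)
⟨$⟩ʳ-injective σ e = trans (sym (inverseˡ σ)) (trans (cong (σ ⟨$⟩ˡ_) e) (inverseˡ σ))

↭-unique : {A : Set} {xs ys : List A} → Unique xs → Unique ys → (∀ {z} → z ∈ xs ⇔ z ∈ ys) → xs ↭ ys
↭-unique ux uy same = ∼bag⇒↭ (unique∧set⇒bag ux uy same)

length-filter-map : {A B : Set} {P : B → Set} (P? : ∀ x → Dec (P x)) (g : A → B) (xs : List A) →
  length (filter P? (map g xs)) ≡ length (filter (P? ∘ g) xs)
length-filter-map P? g []       = refl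
length-filter-map P? g (x ∷ xs) with P? (g x)
... | yes _ = cong suc (length-filter-map P? g xs)
... | no _  = length-filter-map P? g xs

tabulate-const : ∀ {A : Set} n (x : A) → tabulate {n = n} (λ _ → x) ≡ replicate n x
tabulate-const zero    x = refl
tabulate-const (suc n) x = cong (x ∷_) (tabulate-const n x)

InjectiveOn : {A B : Set} → (A → B) → List A → Set
InjectiveOn r xs = ∀ {x y} → x ∈ xs → y ∈ xs → r x ≡ r y → x ≡ y

Unique-map⁺ : {A B : Set} (r : A → B) {xs : List A} → Unique xs → InjectiveOn r xs → Unique (map r xs)
Unique-map⁺ r {[]}     []          inj = []
Unique-map⁺ r {x ∷ xs} (x∉ ∷ uxs) inj =
  All.map⁺ (All.tabulate λ {y} y∈ e → All.lookup x∉ y∈ (inj (here refl) (there y∈) e))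
  ∷ Unique-map⁺ r uxs (λ p q → inj (there p) (there q))

Unique-map⁻ : {A B : Set} (r : A → B) {xs : List A} → Unique (map r xs) → InjectiveOn r xs
Unique-map⁻ r {_ ∷ _} (_ ∷ _)   (here refl) (here refl) e = refl
Unique-map⁻ r {_ ∷ _} (rx∉ ∷ _) (here refl) (there y∈)  e = ⊥-elim (All.lookup rx∉ (∈-map⁺ r y∈) e)
Unique-map⁻ r {_ ∷ _} (rx∉ ∷ _) (there x∈)  (here refl) e = ⊥-elim (All.lookup rx∉ (∈-map⁺ r x∈) (sym e))
Unique-map⁻ r {_ ∷ _} (_ ∷ u)   (there x∈)  (there y∈)  e = Unique-map⁻ r u x∈ y∈ e

Star-⇔ : {A : Set} {R S : Rel A 0ℓ} → R ⇒ Star S → S ⇒ Star R →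
         ∀ {a b} → Star R a b ⇔ Star S a b
Star-⇔ R⇒S S⇒R = mk⇔ (kleisliStar id R⇒S) (kleisliStar id S⇒R)

Star-preserves-label : {A : Set} {R : Rel A 0ℓ} (g : A → ℕ) →
  (∀ {a b} → R a b → g a ≡ g b) → ∀ {a b} → Star R a b → g a ≡ g b
Star-preserves-label g resp = fold (λ a b → g a ≡ g b) (λ r e → trans (resp r) e) refl

Star-∘-permutation : ∀ {n} {R : Rel (Fin n) 0ℓ} (σ : Permutation′ n) {a b} →
  Star R (σ ⟨$⟩ʳ a) (σ ⟨$⟩ʳ b) ⇔ Star (λ x y → R (σ ⟨$⟩ʳ x) (σ ⟨$⟩ʳ y)) a b
Star-∘-permutation {R = R} σ = mk⇔
  (subst₂ (Star _) (inverseˡ σ) (inverseˡ σ)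
     ∘ gmap (σ ⟨$⟩ˡ_) (subst₂ R (sym (inverseʳ σ)) (sym (inverseʳ σ))))
  (gmap (σ ⟨$⟩ʳ_) id)

KerIsClosure : {A : Set} → (A → ℕ) → Rel A 0ℓ → Set
KerIsClosure {A} ρ R = (a b : A) → (ρ a ≡ ρ b) ⇔ Star R a b

KerIsClosure-resp : {A : Set} {ρ : A → ℕ} {R S : Rel A 0ℓ} →
  R ⇒ Star S → S ⇒ Star R → KerIsClosure ρ R → KerIsClosure ρ S
KerIsClosure-resp R⇒S S⇒R ker a b = ⇔.trans (ker a b) (Star-⇔ R⇒S S⇒R)

KerIsClosure-unique : {A : Set} {f g : A → ℕ} {R : Rel A 0ℓ} →
  KerIsClosure f R → KerIsClosure g R → SameKer f g
KerIsClosure-unique kf kg a b = ⇔.trans (kf a b) (⇔.sym (kg a b))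

SameKer-refl : {X : Set} (f : X → ℕ) → SameKer f f
SameKer-refl f x y = ⇔.refl

SameKer-sym : {X : Set} {f g : X → ℕ} → SameKer f g → SameKer g f
SameKer-sym s x y = ⇔.sym (s x y)

SameKer-trans : {X : Set} {f g h : X → ℕ} → SameKer f g → SameKer g h → SameKer f h
SameKer-trans s t x y = ⇔.trans (s x y) (t x y)

≗⇒SameKer : {X : Set} {f g : X → ℕ} → (∀ x → f x ≡ g x) → SameKer f g
≗⇒SameKer f≗g x y = mk⇔ (λ e → trans (sym (f≗g x)) (trans e (f≗g y)))
                         (λ e → trans (f≗g x) (trans e (sym (f≗g y))))

SameKer-∘ : {X Y : Set} {f g : X → ℕ} (h : Y → X) → SameKer f g → SameKer (f ∘ h) (g ∘ h)
SameKer-∘ h s x y = s (h x) (h y)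

injectives-SameKer : {X : Set} {f g : X → ℕ} → Injective _≡_ _≡_ f → Injective _≡_ _≡_ g → SameKer f g
injectives-SameKer inj-f inj-g a b = mk⇔ (λ e → cong _ (inj-f e)) (λ e → cong _ (inj-g e))

module _ {k : ℕ} where

  Swap : Fin k → Fin k → Rel (Fin k) 0ℓ
  Swap a b x y = (x ≡ a × y ≡ b) ⊎ (x ≡ b × y ≡ a)

  merge : (Fin k → ℕ) → Fin k → Fin k → Fin k → ℕ
  merge f a b x with f x ≟ f b
  ... | yes _ = f a
  ... | no _  = f x

  private
    merge-cong : ∀ f a b {x y} → f x ≡ f y → merge f a b x ≡ merge f a b y
    merge-cong f a b {x} {y} e with f x ≟ f b | f y ≟ f b
    ... | yes _   | yes _   = refl
    ... | yes x≡b | no y≢b  = ⊥-elim (y≢b (trans (sym e) x≡b))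
    ... | no x≢b  | yes y≡b = ⊥-elim (x≢b (trans e y≡b))
    ... | no _    | no _    = e

    merge-a : ∀ f a b → merge f a b a ≡ f a
    merge-a f a b with f a ≟ f b
    ... | yes _ = refl
    ... | no _  = refl

    merge-b : ∀ f a b → merge f a b b ≡ f a
    merge-b f a b with f b ≟ f b
    ... | yes _ = refl
    ... | no b≢b = ⊥-elim (b≢b refl)

  merge-ker : ∀ {f R} a b → KerIsClosure f R → KerIsClosure (merge f a b) (R ∪ Swap a b)
  merge-ker {f} {R} a b ker x y = mk⇔ connect (Star-preserves-label (merge f a b) step)
    where
    lift : ∀ {p q} → f p ≡ f q → Star (R ∪ Swap a b) p q
    lift e = Star.map inj₁ (to (ker _ _) e)
    step : ∀ {p q} → (R ∪ Swap a b) p q → merge f a b p ≡ merge f a b q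
    step (inj₁ r)                  = merge-cong f a b (from (ker _ _) (return r))
    step (inj₂ (inj₁ (refl , refl))) = trans (merge-a f a b) (sym (merge-b f a b))
    step (inj₂ (inj₂ (refl , refl))) = trans (merge-b f a b) (sym (merge-a f a b))
    connect : merge f a b x ≡ merge f a b y → Star (R ∪ Swap a b) x y
    connect e with f x ≟ f b | f y ≟ f b
    ... | yes x≡b | yes y≡b = lift (trans x≡b (sym y≡b))
    ... | yes x≡b | no _    = lift x≡b ◅◅ inj₂ (inj₂ (refl , refl)) ◅ lift e
    ... | no _    | yes y≡b = lift e ◅◅ inj₂ (inj₁ (refl , refl)) ◅ lift (sym y≡b)
    ... | no _    | no _    = lift e

  SwapIn : List (Fin k × Fin k) → Rel (Fin k) 0ℓ
  SwapIn ps x y = Any (λ p → Swap (proj₁ p) (proj₂ p) x y) ps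

  mergeAll : (Fin k → ℕ) → List (Fin k × Fin k) → Fin k → ℕ
  mergeAll f []             = f
  mergeAll f ((a , b) ∷ ps) = mergeAll (merge f a b) ps

  mergeAll-ker : ∀ {f R} ps → KerIsClosure f R → KerIsClosure (mergeAll f ps) (R ∪ SwapIn ps)
  mergeAll-ker [] ker = KerIsClosure-resp (return ∘ inj₁) absorb ker
    where
    absorb : _ ⇒ Star _
    absorb (inj₁ r) = return r
    absorb (inj₂ ())
  mergeAll-ker {R = R} ((a , b) ∷ ps) ker =
    KerIsClosure-resp reassoc unassoc (mergeAll-ker ps (merge-ker a b ker))
    where
    reassoc : (R ∪ Swap a b) ∪ SwapIn ps ⇒ Star (R ∪ SwapIn ((a , b) ∷ ps))
    reassoc (inj₁ (inj₁ r)) = return (inj₁ r)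
    reassoc (inj₁ (inj₂ s)) = return (inj₂ (here s))
    reassoc (inj₂ s)        = return (inj₂ (there s))
    unassoc : R ∪ SwapIn ((a , b) ∷ ps) ⇒ Star ((R ∪ Swap a b) ∪ SwapIn ps)
    unassoc (inj₁ r)         = return (inj₁ (inj₁ r))
    unassoc (inj₂ (here s))  = return (inj₁ (inj₂ s))
    unassoc (inj₂ (there s)) = return (inj₂ s)

  kernel-exists : {R : Rel (Fin k) 0ℓ} → Decidable R → Symmetric R → Σ (Fin k → ℕ) λ ρ → KerIsClosure ρ R
  kernel-exists {R} R? R-sym =
    mergeAll toℕ related , KerIsClosure-resp collapse expand (mergeAll-ker related ker-toℕ)
    where
    R?′ : (p : Fin k × Fin k) → Dec (R (proj₁ p) (proj₂ p))
    R?′ p = R? (proj₁ p) (proj₂ p)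
    pairs = cartesianProduct (allFin k) (allFin k)
    related = filter R?′ pairs
    ker-toℕ : KerIsClosure toℕ _≡_
    ker-toℕ a b = mk⇔ (return ∘ Fin.toℕ-injective) (Star-preserves-label toℕ (cong toℕ))
    collapse : _≡_ ∪ SwapIn related ⇒ Star R
    collapse (inj₁ refl) = ε
    collapse (inj₂ s) with find s
    ... | _ , p∈ , swap with proj₂ (∈-filter⁻ R?′ {xs = pairs} p∈) | swap
    ...   | r | inj₁ (refl , refl) = return r
    ...   | r | inj₂ (refl , refl) = return (R-sym r)
    expand : R ⇒ Star (_≡_ ∪ SwapIn related)
    expand {a} {b} r = return (inj₂ (lose (∈-filter⁺ R?′ (∈-cartesianProduct⁺ (∈-allFin a) (∈-allFin b)) r)
                                           (inj₁ (refl , refl))))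

-- Joins of set partitions

AnyEdge : {X : Set} → List (X → ℕ) → Rel X 0ℓ
AnyEdge qs a b = Any (λ q → q a ≡ q b) qs

join-exists : ∀ {k} (qs : List (SetPart k)) → Σ (SetPart k) λ ρ → KerIsClosure ρ (AnyEdge qs)
join-exists qs = kernel-exists (λ a b → any? (λ q → q a ≟ q b) qs) (Any.map sym)

KerIsClosure-[] : {X : Set} {ρ : X → ℕ} → Injective _≡_ _≡_ ρ → KerIsClosure ρ (AnyEdge [])
KerIsClosure-[] {ρ = ρ} inj a b = mk⇔ (λ e → subst (Star _ a) (inj e) ε) (Star-preserves-label ρ λ ())

KerIsClosure-[]⇒injective : {X : Set} {ρ : X → ℕ} → KerIsClosure ρ (AnyEdge []) → Injective _≡_ _≡_ ρ
KerIsClosure-[]⇒injective ker {a} {b} e with to (ker a b) e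
... | ε = refl

KerIsClosure-[_] : {X : Set} (q : X → ℕ) → KerIsClosure q (AnyEdge (q ∷ []))
KerIsClosure-[ q ] a b = mk⇔ (return ∘ here) (Star-preserves-label q λ { (here e) → e })

KerIsClosure-++ : {X : Set} {u v J : X → ℕ} {us vs : List (X → ℕ)} →
  KerIsClosure u (AnyEdge us) → KerIsClosure v (AnyEdge vs) →
  KerIsClosure J (AnyEdge (u ∷ v ∷ [])) → KerIsClosure J (AnyEdge (us ++ vs))
KerIsClosure-++ {us = us} ker-u ker-v = KerIsClosure-resp split merge′
  where
  split : AnyEdge _ ⇒ Star (AnyEdge (us ++ _))
  split (here e)         = Star.map Any.++⁺ˡ (to (ker-u _ _) e)
  split (there (here e)) = Star.map (Any.++⁺ʳ us) (to (ker-v _ _) e)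
  merge′ : AnyEdge (us ++ _) ⇒ Star (AnyEdge _)
  merge′ t with Any.++⁻ us t
  ... | inj₁ t-u = return (here (from (ker-u _ _) (return t-u)))
  ... | inj₂ t-v = return (there (here (from (ker-v _ _) (return t-v))))

KerIsClosure-∘-permutation : ∀ {n} {ρ : Fin n → ℕ} {qs : List (Fin n → ℕ)} (σ : Permutation′ n) →
  KerIsClosure ρ (AnyEdge qs) →
  KerIsClosure (ρ ∘ (σ ⟨$⟩ʳ_)) (AnyEdge (map (_∘ (σ ⟨$⟩ʳ_)) qs))
KerIsClosure-∘-permutation σ ker a b =
  ⇔.trans (ker (σ ⟨$⟩ʳ a) (σ ⟨$⟩ʳ b))
    (⇔.trans (Star-∘-permutation σ) (Star-⇔ (return ∘ Any.map⁺) (return ∘ Any.map⁻)))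

KerIsClosure-injectiveˡ : {X : Set} {u : X → ℕ} (v : X → ℕ) →
  Injective _≡_ _≡_ u → KerIsClosure v (AnyEdge (u ∷ v ∷ []))
KerIsClosure-injectiveˡ v inj a b = mk⇔ (return ∘ there ∘ here)
  (Star-preserves-label v λ { (here e) → cong v (inj e) ; (there (here e)) → e })

KerIsClosure-injectiveʳ : {X : Set} (u : X → ℕ) {v : X → ℕ} →
  Injective _≡_ _≡_ v → KerIsClosure u (AnyEdge (u ∷ v ∷ []))
KerIsClosure-injectiveʳ u inj a b = mk⇔ (return ∘ here)
  (Star-preserves-label u λ { (here e) → e ; (there (here e)) → cong u (inj e) })

count : ∀ {n} → (Fin n → ℕ) → ℕ → ℕ
count {n} f m = length (filter (λ i → f i ≟ m) (allFin n))

labels : ∀ {n} → (Fin n → ℕ) → List ℕ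
labels {n} f = map f (allFin n)

count-resp : ∀ {n} {f g : Fin n → ℕ} {m m′} → (∀ i → (f i ≡ m) ⇔ (g i ≡ m′)) → count f m ≡ count g m′
count-resp {n} {f} {g} {m} {m′} same = cong length
  (List.filter-≐ (λ i → f i ≟ m) (λ i → g i ≟ m′) ((λ {i} → to (same i)) , (λ {i} → from (same i))) (allFin n))

allFin-permutation : ∀ {n} (σ : Permutation′ n) → map (σ ⟨$⟩ʳ_) (allFin n) ↭ allFin n
allFin-permutation {n} σ = ↭-unique (Unique.map⁺ (⟨$⟩ʳ-injective σ) (Unique.allFin⁺ n)) (Unique.allFin⁺ n)
  (mk⇔ (λ _ → ∈-allFin _) (λ _ → subst (_∈ _) (inverseʳ σ) (∈-map⁺ (σ ⟨$⟩ʳ_) (∈-allFin _))))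

count-∘-permutation : ∀ {n} (f : Fin n → ℕ) (σ : Permutation′ n) m → count (f ∘ (σ ⟨$⟩ʳ_)) m ≡ count f m
count-∘-permutation {n} f σ m = trans (sym (length-filter-map (λ i → f i ≟ m) (σ ⟨$⟩ʳ_) (allFin n)))
  (↭-length (filter-↭ (λ i → f i ≟ m) (allFin-permutation σ)))

allFin-punchIn : ∀ {n} (j : Fin (suc n)) → allFin (suc n) ↭ j ∷ map (punchIn j) (allFin n)
allFin-punchIn {n} j = ↭-unique (Unique.allFin⁺ (suc n))
  (All.map⁺ (All.tabulate⁺ λ i e → Fin.punchInᵢ≢i j i (sym e))
   ∷ Unique.map⁺ (Fin.punchIn-injective j _ _) (Unique.allFin⁺ n))
  (mk⇔ (λ _ → covered _) (λ _ → ∈-allFin _))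
  where
  covered : ∀ z → z ∈ j ∷ map (punchIn j) (allFin n)
  covered z with j Fin.≟ z
  ... | yes refl = here refl
  ... | no j≢z   = there (subst (_∈ _) (Fin.punchIn-punchOut j≢z) (∈-map⁺ (punchIn j) (∈-allFin (punchOut j≢z))))

module _ {n} (f : Fin (suc n) → ℕ) (j : Fin (suc n)) {m : ℕ} where
  private
    P? = λ i → f i ≟ m
    count-split : count f m ≡ length (filter P? (j ∷ map (punchIn j) (allFin n)))
    count-split = ↭-length (filter-↭ P? (allFin-punchIn j))

  count-punchIn-hit : f j ≡ m → count f m ≡ suc (count (f ∘ punchIn j) m)
  count-punchIn-hit hit = trans count-split
    (trans (cong length (List.filter-accept P? hit)) (cong suc (length-filter-map P? (punchIn j) (allFin n))))

  count-punchIn-miss : f j ≢ m → count f m ≡ count (f ∘ punchIn j) m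
  count-punchIn-miss miss = trans count-split
    (trans (cong length (List.filter-reject P? miss)) (length-filter-map P? (punchIn j) (allFin n)))

count≡0 : ∀ {n} (f : Fin n → ℕ) m → (∀ j → f j ≢ m) → count f m ≡ 0
count≡0 f m absent = cong length (List.filter-none (λ i → f i ≟ m) (All.tabulate⁺ absent))

∈-labels⇔count≢0 : ∀ {n} (f : Fin n → ℕ) m → m ∈ labels f ⇔ (count f m ≢ 0)
∈-labels⇔count≢0 {n} f m = mk⇔ present witness
  where
  P? = λ i → f i ≟ m
  present : m ∈ labels f → count f m ≢ 0
  present m∈ c≡0 with ∈-map⁻ f m∈
  ... | j , _ , refl = ℕ.<⇒≢ (List.filter-some P? (lose (∈-allFin j) refl)) (sym c≡0)
  witness : count f m ≢ 0 → m ∈ labels f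
  witness c≢0 with filter P? (allFin n) in eq
  ... | []    = ⊥-elim (c≢0 refl)
  ... | j ∷ _ = subst (_∈ labels f) (proj₂ (∈-filter⁻ P? {xs = allFin n} (subst (j ∈_) (sym eq) (here refl))))
                  (∈-map⁺ f (∈-allFin j))

∈-labels-resp-count : ∀ {n n′} {f : Fin n → ℕ} {g : Fin n′ → ℕ} → (∀ m → count f m ≡ count g m) →
  ∀ {m} → m ∈ labels f → m ∈ labels g
∈-labels-resp-count {f = f} {g} same {m} m∈ =
  from (∈-labels⇔count≢0 g m) (λ c≡0 → to (∈-labels⇔count≢0 f m) m∈ (trans (same m) c≡0))

counts⇒permutation : ∀ {n} (f g : Fin n → ℕ) → (∀ m → count f m ≡ count g m) →
  Σ (Permutation′ n) λ σ → ∀ x → g x ≡ f (σ ⟨$⟩ʳ x)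
counts⇒permutation {zero}  f g same = Perm.id , λ ()
counts⇒permutation {suc n} f g same with ∈-map⁻ g (∈-labels-resp-count {f = f} {g} same (∈-map⁺ f (∈-allFin zero)))
... | j , _ , f₀≡gj = insert j zero (proj₁ rec) , matched
  where
  rest : ∀ m → count (f ∘ suc) m ≡ count (g ∘ punchIn j) m
  rest m with f zero ≟ m
  ... | yes hit = ℕ.suc-injective (trans (sym (count-punchIn-hit f zero hit))
                    (trans (same m) (count-punchIn-hit g j (trans (sym f₀≡gj) hit))))
  ... | no miss = trans (sym (count-punchIn-miss f zero miss))
                    (trans (same m) (count-punchIn-miss g j (miss ∘ trans f₀≡gj)))
  rec = counts⇒permutation (f ∘ suc) (g ∘ punchIn j) rest
  matched : ∀ x → g x ≡ f (insert j zero (proj₁ rec) ⟨$⟩ʳ x)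
  matched x with j Fin.≟ x
  ... | yes refl = sym f₀≡gj
  ... | no j≢x   = trans (cong g (sym (Fin.punchIn-punchOut j≢x))) (proj₂ rec (punchOut j≢x))

count-injective : ∀ {n} (γ : Fin n → ℕ) → Injective _≡_ _≡_ γ → ∀ i → count γ (γ i) ≡ 1
count-injective {suc n} γ inj i =
  trans (count-punchIn-hit γ i refl) (cong suc (count≡0 _ _ λ j e → Fin.punchInᵢ≢i i j (inj e)))

-- typeSP f is definitionally map (count f) (blocks f), and countTop x is
-- count (x ∘ inj₁).
blocks : ∀ {n} → (Fin n → ℕ) → List ℕ
blocks f = deduplicate _≟_ (labels f)

blocks-↭ : ∀ {n n′} {f : Fin n → ℕ} {g : Fin n′ → ℕ} →
  (∀ {m} → m ∈ labels f → m ∈ labels g) → (∀ {m} → m ∈ labels g → m ∈ labels f) → blocks f ↭ blocks g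
blocks-↭ f⊆g g⊆f = ↭-unique (deduplicate-! _) (deduplicate-! _)
  (mk⇔ (to dedup-∈ ∘ f⊆g ∘ from dedup-∈) (to dedup-∈ ∘ g⊆f ∘ from dedup-∈))
  where dedup-∈ = λ {xs} {z} → deduplicate-∈⇔ _≟_ {xs} {z}

∈-blocks⁺ : ∀ {n} (f : Fin n → ℕ) i → f i ∈ blocks f
∈-blocks⁺ f i = ∈-deduplicate⁺ _≟_ (∈-map⁺ f (∈-allFin i))

∈-blocks⁻ : ∀ {n} (f : Fin n → ℕ) {m} → m ∈ blocks f → ∃ λ i → f i ≡ m
∈-blocks⁻ f m∈ with ∈-map⁻ f (∈-deduplicate⁻ _≟_ _ m∈)
... | i , _ , m≡fi = i , sym m≡fi

typeSP-resp-count : ∀ {n n′} (f : Fin n → ℕ) (g : Fin n′ → ℕ) →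
  (∀ m → count f m ≡ count g m) → typeSP f ↭ typeSP g
typeSP-resp-count f g same =
  ↭-trans (↭-reflexive (List.map-cong same (blocks f)))
          (map⁺ (count g) (blocks-↭ (∈-labels-resp-count same) (∈-labels-resp-count (sym ∘ same))))

typeSP-∘-permutation : ∀ {n} (f : Fin n → ℕ) (σ : Permutation′ n) → typeSP (f ∘ (σ ⟨$⟩ʳ_)) ↭ typeSP f
typeSP-∘-permutation f σ = typeSP-resp-count _ f (count-∘-permutation f σ)

RelabelsInjectively : ∀ {n} → (ℕ → ℕ) → (Fin n → ℕ) → Set
RelabelsInjectively {n} r f = (i j : Fin n) → r (f i) ≡ r (f j) → f i ≡ f j

count-relabel : ∀ {n} {r : ℕ → ℕ} {f : Fin n → ℕ} → RelabelsInjectively r f →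
  ∀ i → count (r ∘ f) (r (f i)) ≡ count f (f i)
count-relabel {r = r} inj i = count-resp λ j → mk⇔ (inj j i) (cong r)

typeSP-relabel : ∀ {n} (r : ℕ → ℕ) (f : Fin n → ℕ) → RelabelsInjectively r f → typeSP (r ∘ f) ↭ typeSP f
typeSP-relabel r f inj = ↭-trans (map⁺ (count (r ∘ f)) blocks-relabel)
  (↭-reflexive (trans (sym (List.map-∘ (blocks f))) (List.map-cong-local (All.tabulate same-count))))
  where
  injOn : InjectiveOn r (blocks f)
  injOn l∈ l′∈ e with ∈-blocks⁻ f l∈ | ∈-blocks⁻ f l′∈
  ... | i , refl | j , refl = inj i j e
  blocks-relabel : blocks (r ∘ f) ↭ map r (blocks f)
  blocks-relabel = ↭-unique (deduplicate-! _) (Unique-map⁺ r (deduplicate-! _) injOn) (mk⇔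
    (λ z∈ → let i , e = ∈-blocks⁻ (r ∘ f) z∈ in subst (_∈ _) e (∈-map⁺ r (∈-blocks⁺ f i)))
    (λ z∈ → let l , l∈ , e = ∈-map⁻ r z∈ ; i , e′ = ∈-blocks⁻ f l∈ in
       subst (_∈ blocks (r ∘ f)) (sym (trans e (cong r (sym e′)))) (∈-blocks⁺ (r ∘ f) i)))
  same-count : ∀ {l} → l ∈ blocks f → count (r ∘ f) (r l) ≡ count f l
  same-count l∈ with ∈-blocks⁻ f l∈
  ... | i , refl = count-relabel {r = r} inj i

SameKer⇒relabelling : ∀ {n} {f h : Fin n → ℕ} → SameKer f h → Σ (ℕ → ℕ) λ r → ∀ i → r (f i) ≡ h i
SameKer⇒relabelling {f = f} {h} same = r , r∘f≗h
  where
  r : ℕ → ℕ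
  r l with Fin.any? (λ i → f i ≟ l)
  ... | yes (i , _) = h i
  ... | no _        = 0
  r∘f≗h : ∀ i → r (f i) ≡ h i
  r∘f≗h i with Fin.any? (λ j → f j ≟ f i)
  ... | yes (j , fj≡fi) = to (same j i) fj≡fi
  ... | no none         = ⊥-elim (none (i , refl))

typeSP-resp-SameKer : ∀ {n} (f h : Fin n → ℕ) → SameKer f h → typeSP f ↭ typeSP h
typeSP-resp-SameKer f h same with SameKer⇒relabelling same
... | r , r∘f≗h = ↭-trans (↭-sym (typeSP-relabel r f relabels)) (typeSP-resp-count (r ∘ f) h same-count)
  where
  relabels : RelabelsInjectively r f
  relabels i j e = from (same i j) (trans (sym (r∘f≗h i)) (trans e (r∘f≗h j)))
  same-count : ∀ m → count (r ∘ f) m ≡ count h m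
  same-count m = count-resp λ i → mk⇔ (trans (sym (r∘f≗h i))) (trans (r∘f≗h i))

↭-map-matching : (c d : ℕ → ℕ) (xs ys : List ℕ) → Unique xs → map c xs ↭ map d ys →
  Σ (ℕ → ℕ) λ r → (∀ {x} → x ∈ xs → d (r x) ≡ c x) × map r xs ↭ ys
↭-map-matching c d [] ys _ p with ↭-empty-inv (↭-sym p)
↭-map-matching c d [] [] _ p | refl = (λ _ → 0) , (λ ()) , ↭-refl
↭-map-matching c d (x ∷ xs) ys (x∉ ∷ uxs) p with ∈-map⁻ d (∈-resp-↭ p (here refl))
... | y , y∈ , cx≡dy with ∈-∃++ y∈
... | as , bs , refl = r , matches , r-onto
  where
  remove-y : map d (as ++ y ∷ bs) ↭ c x ∷ map d (as ++ bs)
  remove-y = subst (λ t → map d (as ++ y ∷ bs) ↭ t ∷ map d (as ++ bs)) (sym cx≡dy) (map⁺ d (shift y as bs))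
  rec = ↭-map-matching c d xs (as ++ bs) uxs (drop-∷ (↭-trans p remove-y))
  r : ℕ → ℕ
  r z with z ≟ x
  ... | yes _ = y
  ... | no _  = proj₁ rec z
  r-x : r x ≡ y
  r-x with x ≟ x
  ... | yes _  = refl
  ... | no x≢x = ⊥-elim (x≢x refl)
  r-rest : ∀ {z} → z ∈ xs → r z ≡ proj₁ rec z
  r-rest {z} z∈ with z ≟ x
  ... | yes refl = ⊥-elim (All.lookup x∉ z∈ refl)
  ... | no _     = refl
  matches : ∀ {z} → z ∈ x ∷ xs → d (r z) ≡ c z
  matches (here refl) = trans (cong d r-x) (sym cx≡dy)
  matches (there z∈)  = trans (cong d (r-rest z∈)) (proj₁ (proj₂ rec) z∈)
  r-onto : map r (x ∷ xs) ↭ as ++ y ∷ bs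
  r-onto = ↭-trans (↭-reflexive (cong₂ _∷_ r-x (List.map-cong-local (All.tabulate r-rest))))
           (↭-trans (↭-prep y (proj₂ (proj₂ rec))) (↭-sym (shift y as bs)))

-- Match the blocks of f with blocks of g of the same size and relabel f
-- accordingly; the relabelled f has the label counts of g.
typeSP-↭⇒SameKer : ∀ {n} (f g : Fin n → ℕ) → typeSP f ↭ typeSP g →
  Σ (Permutation′ n) λ σ → SameKer f (g ∘ (σ ⟨$⟩ʳ_))
typeSP-↭⇒SameKer f g types
  with ↭-map-matching (count f) (count g) (blocks f) (blocks g) (deduplicate-! _) types
... | r , matches , r-onto = σ , λ x y → mk⇔
  (λ e → trans (g∘σ≗r∘f x) (trans (cong r e) (sym (g∘σ≗r∘f y))))
  (λ e → relabels x y (trans (sym (g∘σ≗r∘f x)) (trans e (g∘σ≗r∘f y))))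
  where
  relabels : RelabelsInjectively r f
  relabels i j = Unique-map⁻ r (Unique-resp-↭ (↭⇒↭ₛ (↭-sym r-onto)) (deduplicate-! _))
                             (∈-blocks⁺ f i) (∈-blocks⁺ f j)
  same-count : ∀ m → count g m ≡ count (r ∘ f) m
  same-count m with m ∈? map r (blocks f)
  ... | yes m∈ with ∈-map⁻ r m∈
  ...   | l , l∈ , refl with ∈-blocks⁻ f l∈
  ...     | i , refl = trans (matches l∈) (sym (count-relabel {r = r} relabels i))
  same-count m | no m∉ =
    trans (count≡0 g m λ j gj≡m → m∉ (∈-resp-↭ (↭-sym r-onto) (subst (_∈ _) gj≡m (∈-blocks⁺ g j))))
          (sym (count≡0 (r ∘ f) m λ j e → m∉ (subst (_∈ _) e (∈-map⁺ r (∈-blocks⁺ f j)))))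
  σ = proj₁ (counts⇒permutation g (r ∘ f) same-count)
  g∘σ≗r∘f : ∀ x → g (σ ⟨$⟩ʳ x) ≡ r (f x)
  g∘σ≗r∘f x = sym (proj₂ (counts⇒permutation g (r ∘ f) same-count) x)

typeSP-injective : ∀ {n} (γ : Fin n → ℕ) → Injective _≡_ _≡_ γ → typeSP γ ↭ oneK n
typeSP-injective {n} γ inj = ↭-trans (map⁺ (count γ) blocks↭labels) (↭-reflexive (begin
  map (count γ) (map γ (allFin n)) ≡⟨ List.map-∘ (allFin n) ⟨
  map (count γ ∘ γ) (allFin n)     ≡⟨ List.map-cong (count-injective γ inj) (allFin n) ⟩
  map (λ _ → 1) (allFin n)         ≡⟨ List.map-tabulate id (λ _ → 1) ⟩
  tabulate (λ _ → 1)               ≡⟨ tabulate-const n 1 ⟩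
  oneK n                           ∎))
  where
  open ≡-Reasoning
  blocks↭labels : blocks γ ↭ labels γ
  blocks↭labels = ↭-unique (deduplicate-! _) (Unique.map⁺ inj (Unique.allFin⁺ n))
    (⇔.sym (deduplicate-∈⇔ _≟_))

-- Diagrams in normal form

column : ∀ {k} → Permutation′ k → Pt k → Fin k
column α (inj₁ i) = i
column α (inj₂ j) = α ⟨$⟩ʳ j

diagram : ∀ {k} → SetPart k → Permutation′ k → Diagram k
diagram ρ α = ρ ∘ column α

permLabels : ∀ {k} → Permutation′ k → SetPart k
permLabels σ = toℕ ∘ (σ ⟨$⟩ˡ_)

permLabels-injective : ∀ {k} (σ : Permutation′ k) → Injective _≡_ _≡_ (permLabels σ)
permLabels-injective σ = ⟨$⟩ʳ-injective (Perm.flip σ) ∘ Fin.toℕ-injective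

permDiagram≗diagram : ∀ {k} (σ : Permutation′ k) p → permDiagram σ p ≡ diagram (permLabels σ) σ p
permDiagram≗diagram σ (inj₁ j) = refl
permDiagram≗diagram σ (inj₂ i) = cong toℕ (sym (inverseˡ σ))

eDiag≗diagram : ∀ {k} (ρ : SetPart k) p → eDiag ρ p ≡ diagram ρ Perm.id p
eDiag≗diagram ρ (inj₁ i) = refl
eDiag≗diagram ρ (inj₂ j) = refl

InU⇒diagram : ∀ {k} (x : Diagram k) → InU x → Σ (Permutation′ k) λ α → SameKer x (diagram (x ∘ inj₁) α)
InU⇒diagram x balanced with counts⇒permutation (x ∘ inj₁) (x ∘ inj₂) balanced
... | α , bottom≗ = α , ≗⇒SameKer λ { (inj₁ i) → refl ; (inj₂ j) → bottom≗ j }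

typeD-InU : ∀ {k} (x : Diagram k) → InU x → typeD x ↭ typeSP (x ∘ inj₁)
typeD-InU {k} x balanced = map⁺ (count (x ∘ inj₁)) (↭-unique (deduplicate-! _) (deduplicate-! _)
  (mk⇔ (to dedup-∈ ∘ top-label ∘ from dedup-∈) (to dedup-∈ ∘ any-label ∘ from dedup-∈)))
  where
  dedup-∈ = λ {xs} {z} → deduplicate-∈⇔ _≟_ {xs} {z}
  any-label : ∀ {m} → m ∈ labels (x ∘ inj₁) → m ∈ map x (allPt k)
  any-label m∈ with ∈-map⁻ (x ∘ inj₁) m∈
  ... | i , _ , refl = ∈-map⁺ x (∈-++⁺ˡ (∈-map⁺ inj₁ (∈-allFin i)))
  top-label : ∀ {m} → m ∈ map x (allPt k) → m ∈ labels (x ∘ inj₁)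
  top-label m∈ with ∈-map⁻ x m∈
  ... | inj₁ i , _ , refl = ∈-map⁺ (x ∘ inj₁) (∈-allFin i)
  ... | inj₂ j , _ , refl = ∈-labels-resp-count {f = x ∘ inj₂} (sym ∘ balanced) (∈-map⁺ (x ∘ inj₂) (∈-allFin j))

-- Products of diagrams

ProdEdge-resp : ∀ {k} {x x′ y y′ : Diagram k} → SameKer x x′ → SameKer y y′ → ProdEdge x y ⇒ ProdEdge x′ y′
ProdEdge-resp sx sy (inj₁ (p , q , up , uq , e)) = inj₁ (p , q , up , uq , to (sx p q) e)
ProdEdge-resp sx sy (inj₂ (p , q , lp , lq , e)) = inj₂ (p , q , lp , lq , to (sy p q) e)

IsProduct-resp : ∀ {k} {x x′ y y′ z z′ : Diagram k} →
  SameKer x x′ → SameKer y y′ → SameKer z z′ → IsProduct x y z → IsProduct x′ y′ z′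
IsProduct-resp sx sy sz prod a b = ⇔.trans (⇔.sym (sz a b)) (⇔.trans (prod a b)
  (Star-⇔ (return ∘ ProdEdge-resp sx sy) (return ∘ ProdEdge-resp (SameKer-sym sx) (SameKer-sym sy))))

IsProduct-unique : ∀ {k} {x y z z′ : Diagram k} → IsProduct x y z → IsProduct x y z′ → SameKer z z′
IsProduct-unique prod prod′ a b = ⇔.trans (prod a b) (⇔.sym (prod′ a b))

module _ {k} (ρ : SetPart k) (α : Permutation′ k) (ρ′ : SetPart k) (β : Permutation′ k) where
  private
    x = diagram ρ α
    y = diagram ρ′ β
    Middle = AnyEdge (ρ ∘ (α ⟨$⟩ʳ_) ∷ ρ′ ∷ [])

    -- the point of the middle row M to which a point is joined
    mid : Pt3 k → Fin k
    mid (inj₁ i)        = α ⟨$⟩ˡ i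
    mid (inj₂ (inj₁ m)) = m
    mid (inj₂ (inj₂ j)) = β ⟨$⟩ʳ j

    middle : Fin k → Pt3 k
    middle m = inj₂ (inj₁ m)

    upper-label : ∀ p {p′} → onUpper p p′ → x p′ ≡ ρ (α ⟨$⟩ʳ mid p)
    upper-label (inj₁ i)        refl = cong ρ (sym (inverseʳ α))
    upper-label (inj₂ (inj₁ m)) refl = refl

    lower-label : ∀ p {p′} → onLower p p′ → y p′ ≡ ρ′ (mid p)
    lower-label (inj₂ (inj₁ m)) refl = refl
    lower-label (inj₂ (inj₂ j)) refl = refl

    to-middle : ProdEdge x y ⇒ (Middle on mid)
    to-middle {p} {q} (inj₁ (_ , _ , up , uq , e)) = here (trans (sym (upper-label p up)) (trans e (upper-label q uq)))
    to-middle {p} {q} (inj₂ (_ , _ , lp , lq , e)) = there (here (trans (sym (lower-label p lp)) (trans e (lower-label q lq))))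

    from-middle : Middle ⇒ (ProdEdge x y on middle)
    from-middle (here e)         = inj₁ (_ , _ , refl , refl , e)
    from-middle (there (here e)) = inj₂ (_ , _ , refl , refl , e)

    ProdEdge-sym : Symmetric (ProdEdge x y)
    ProdEdge-sym (inj₁ (p , q , up , uq , e)) = inj₁ (q , p , uq , up , sym e)
    ProdEdge-sym (inj₂ (p , q , lp , lq , e)) = inj₂ (q , p , lq , lp , sym e)

    reach-middle : ∀ p → Star (ProdEdge x y) p (middle (mid p))
    reach-middle (inj₁ i)        = return (inj₁ (_ , _ , refl , refl , cong ρ (sym (inverseʳ α))))
    reach-middle (inj₂ (inj₁ m)) = ε
    reach-middle (inj₂ (inj₂ j)) = return (inj₂ (_ , _ , refl , refl , refl))

    connected⇔middle-connected : ∀ p q → Star (ProdEdge x y) p q ⇔ Star Middle (mid p) (mid q)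
    connected⇔middle-connected p q = mk⇔ (gmap mid to-middle)
      (λ s → reach-middle p ◅◅ gmap middle from-middle s ◅◅ reverse ProdEdge-sym (reach-middle q))

  diagram-product : ∀ {J} → KerIsClosure J Middle → IsProduct x y (diagram (J ∘ (α ⟨$⟩ˡ_)) (β ∘ₚ α))
  diagram-product {J} join a b = ⇔.trans (≗⇒SameKer z≗ a b)
    (⇔.trans (join (mid (embed a)) (mid (embed b))) (⇔.sym (connected⇔middle-connected (embed a) (embed b))))
    where
    z≗ : ∀ p → diagram (J ∘ (α ⟨$⟩ˡ_)) (β ∘ₚ α) p ≡ J (mid (embed p))
    z≗ (inj₁ i) = refl
    z≗ (inj₂ j) = cong J (inverseˡ α)

JoinOfType : ∀ {k} → List ℕ → SetPart k → List (SetPart k) → Set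
JoinOfType λ′ ρ qs = KerIsClosure ρ (AnyEdge qs) × All (λ q → typeSP q ↭ λ′) qs

JoinOfType-∘-permutation : ∀ {k λ′} {ρ : SetPart k} {qs} (σ : Permutation′ k) →
  JoinOfType λ′ ρ qs → JoinOfType λ′ (ρ ∘ (σ ⟨$⟩ʳ_)) (map (_∘ (σ ⟨$⟩ʳ_)) qs)
JoinOfType-∘-permutation σ (ker , types) =
  KerIsClosure-∘-permutation σ ker , All.map⁺ (All.map (λ {q} t → ↭-trans (typeSP-∘-permutation q σ) t) types)

JoinOfType-join : ∀ {k λ′} {u v J : SetPart k} {us vs} → JoinOfType λ′ u us → JoinOfType λ′ v vs →
  KerIsClosure J (AnyEdge (u ∷ v ∷ [])) → JoinOfType λ′ J (us ++ vs)
JoinOfType-join (ker-u , types-u) (ker-v , types-v) join = KerIsClosure-++ ker-u ker-v join , All.++⁺ types-u types-v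

JoinOfType⇒Preceq : ∀ {k λ′} {ρ : SetPart k} q qs → JoinOfType λ′ ρ (q ∷ qs) → Preceq k (typeSP ρ) λ′
JoinOfType⇒Preceq {ρ = ρ} q qs (ker , types) =
  length qs , lookup (q ∷ qs) , All.lookup types ∘ ∈-lookup , ρ ,
  (λ a b → ⇔.trans (ker a b) (Star-⇔ (λ t → return (Any.index t , Any.lookup-index t))
                                      (λ { (j , e) → return (lose (∈-lookup j) e) }))) ,
  ↭-refl

-- ps zero ∷ map ps (tabulate suc) is map ps (allFin (suc ℓ)) by definition.
Preceq⇒JoinOfType : ∀ {k μ λ′} → Preceq k μ λ′ →
  Σ (SetPart k) λ ρ → Σ (SetPart k) λ q → Σ (List (SetPart k)) λ qs → JoinOfType λ′ ρ (q ∷ qs) × typeSP ρ ↭ μ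
Preceq⇒JoinOfType (ℓ , ps , types , ρ , ker , type-ρ) =
  ρ , ps zero , map ps (tabulate suc) ,
  ((λ a b → ⇔.trans (ker a b) (Star-⇔ (λ { (j , e) → return (Any.map⁺ (lose (∈-allFin j) e)) })
                                       (λ t → let j , _ , e = find (Any.map⁻ t) in return (j , e)))) ,
   All.map⁺ (All.tabulate⁺ types)) ,
  type-ρ

Preceq-resp : ∀ {k μ μ′ λ′} → μ ↭ μ′ → Preceq k μ λ′ → Preceq k μ′ λ′
Preceq-resp μ↭μ′ (ℓ , ps , types , h , ker , type-h) = ℓ , ps , types , h , ker , ↭-trans type-h μ↭μ′

-- The generated monoid

module _ {k} {π : SetPart k} where

  InGen-resp : ∀ {x x′} → SameKer x x′ → InGen π x → InGen π x′
  InGen-resp sx (gen-perm (σ , s)) = gen-perm (σ , SameKer-trans (SameKer-sym sx) s)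
  InGen-resp sx (gen-e s)          = gen-e (SameKer-trans (SameKer-sym sx) s)
  InGen-resp sx (gen-mul gx gy xy) = gen-mul gx gy (IsProduct-resp (SameKer-refl _) (SameKer-refl _) sx xy)

  InGen-permutation : (σ : Permutation′ k) → InGen π (diagram (permLabels σ) σ)
  InGen-permutation σ = gen-perm (σ , SameKer-sym (≗⇒SameKer (permDiagram≗diagram σ)))

  InGen-e : InGen π (diagram π Perm.id)
  InGen-e = gen-e (SameKer-sym (≗⇒SameKer (eDiag≗diagram π)))

  InGen-product : ∀ ρ α ρ′ β {J} → KerIsClosure J (AnyEdge (ρ ∘ (α ⟨$⟩ʳ_) ∷ ρ′ ∷ [])) →
    InGen π (diagram ρ α) → InGen π (diagram ρ′ β) → InGen π (diagram (J ∘ (α ⟨$⟩ˡ_)) (β ∘ₚ α))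
  InGen-product ρ α ρ′ β join gx gy = gen-mul gx gy (diagram-product ρ α ρ′ β join)

  InGen-mul-permˡ : ∀ ρ α σ → InGen π (diagram ρ α) → InGen π (diagram (ρ ∘ (σ ⟨$⟩ˡ_)) (α ∘ₚ σ))
  InGen-mul-permˡ ρ α σ g = InGen-product (permLabels σ) σ ρ α
    (KerIsClosure-injectiveˡ ρ (⟨$⟩ʳ-injective σ ∘ permLabels-injective σ))
    (InGen-permutation σ) g

  InGen-mul-permʳ : ∀ ρ α τ → InGen π (diagram ρ α) → InGen π (diagram ρ (τ ∘ₚ α))
  InGen-mul-permʳ ρ α τ g = InGen-resp (≗⇒SameKer λ p → cong ρ (inverseʳ α))
    (InGen-product ρ α (permLabels τ) τ (KerIsClosure-injectiveʳ (ρ ∘ (α ⟨$⟩ʳ_)) (permLabels-injective τ))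
                   g (InGen-permutation τ))

  InGen-conj : ∀ {h} → InGen π (diagram h Perm.id) → ∀ σ α → InGen π (diagram (h ∘ (σ ⟨$⟩ʳ_)) α)
  InGen-conj {h} g σ α = InGen-resp (≗⇒SameKer λ { (inj₁ i) → refl ; (inj₂ j) → cong h (inverseʳ σ) })
    (InGen-mul-permʳ _ _ (α ∘ₚ σ) (InGen-mul-permˡ h Perm.id (Perm.flip σ) g))

  InGen-join : ∀ q qs {H} → All (λ p → InGen π (diagram p Perm.id)) (q ∷ qs) →
    KerIsClosure H (AnyEdge (q ∷ qs)) → InGen π (diagram H Perm.id)
  InGen-join q [] (g ∷ []) ker-H =
    InGen-resp (SameKer-∘ (column Perm.id) (KerIsClosure-unique KerIsClosure-[ q ] ker-H)) g
  InGen-join q (q′ ∷ qs) (g ∷ gs) ker-H with join-exists (q′ ∷ qs)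
  ... | H′ , ker-H′ with join-exists (q ∷ H′ ∷ [])
  ...   | J , ker-J = InGen-resp (SameKer-∘ (column Perm.id) J~H)
                        (InGen-product q Perm.id H′ Perm.id ker-J g (InGen-join q′ qs gs ker-H′))
    where
    J~H : SameKer J _
    J~H = KerIsClosure-unique (KerIsClosure-++ KerIsClosure-[ q ] ker-H′ ker-J) ker-H

module _ {k} (π : SetPart k) where

  HasJoinForm : Diagram k → Set
  HasJoinForm x = Σ (SetPart k) λ ρ → Σ (Permutation′ k) λ α → Σ (List (SetPart k)) λ qs →
    SameKer x (diagram ρ α) × JoinOfType (typeSP π) ρ qs

  InGen⇒HasJoinForm : ∀ {x} → InGen π x → HasJoinForm x
  InGen⇒HasJoinForm (gen-perm (σ , s)) =
    permLabels σ , σ , [] , SameKer-trans s (≗⇒SameKer (permDiagram≗diagram σ)) ,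
    KerIsClosure-[] (permLabels-injective σ) , []
  InGen⇒HasJoinForm (gen-e s) =
    π , Perm.id , π ∷ [] , SameKer-trans s (≗⇒SameKer (eDiag≗diagram π)) , KerIsClosure-[ π ] , ↭-refl ∷ []
  InGen⇒HasJoinForm (gen-mul gx gy xy)
    with InGen⇒HasJoinForm gx | InGen⇒HasJoinForm gy
  ... | ρ , α , qs , sx , join-ρ | ρ′ , β , qs′ , sy , join-ρ′
    with join-exists (ρ ∘ (α ⟨$⟩ʳ_) ∷ ρ′ ∷ [])
  ...   | J , ker-J =
    J ∘ (α ⟨$⟩ˡ_) , β ∘ₚ α , _ ,
    IsProduct-unique (IsProduct-resp sx sy (SameKer-refl _) xy) (diagram-product ρ α ρ′ β ker-J) ,
    JoinOfType-∘-permutation (Perm.flip α) (JoinOfType-join (JoinOfType-∘-permutation α join-ρ) join-ρ′ ker-J)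

  InGen-of-same-type : ∀ {ρ h} → typeSP ρ ↭ typeSP h → InGen π (diagram h Perm.id) → ∀ α → InGen π (diagram ρ α)
  InGen-of-same-type {ρ} {h} types g α with typeSP-↭⇒SameKer ρ h types
  ... | σ , ρ~h∘σ = InGen-resp (SameKer-∘ (column α) (SameKer-sym ρ~h∘σ)) (InGen-conj {h = h} g σ α)

  Preceq⇒InGen : ∀ {μ} → Preceq k μ (typeSP π) → Σ (SetPart k) λ h → InGen π (diagram h Perm.id) × typeSP h ↭ μ
  Preceq⇒InGen P with Preceq⇒JoinOfType P
  ... | h , q , qs , (ker , types) , type-h =
    h , InGen-join q qs (All.map (λ t → InGen-of-same-type t InGen-e Perm.id) types) ker , type-h

  PermOrTypeBelow : Diagram k → Set
  PermOrTypeBelow x = IsPerm x ⊎ Σ (List ℕ) (λ μ → Preceq k μ (typeSP π) × (typeD x ↭ μ))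

  InGen⇒PermOrTypeBelow : ∀ x → InU x → InGen π x → PermOrTypeBelow x
  InGen⇒PermOrTypeBelow x balanced g with InGen⇒HasJoinForm g
  ... | ρ , α , [] , sx , ker , [] =
    inj₁ (α , SameKer-trans sx (SameKer-trans
      (SameKer-∘ (column α) (injectives-SameKer (KerIsClosure-[]⇒injective ker) (permLabels-injective α)))
      (SameKer-sym (≗⇒SameKer (permDiagram≗diagram α)))))
  ... | ρ , α , q ∷ qs , sx , join-ρ =
    inj₂ (typeSP ρ , JoinOfType⇒Preceq q qs join-ρ ,
          ↭-trans (typeD-InU x balanced) (typeSP-resp-SameKer (x ∘ inj₁) ρ (SameKer-∘ inj₁ sx)))

  PermOrTypeBelow⇒InGen : ∀ x → InU x → PermOrTypeBelow x → InGen π x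
  PermOrTypeBelow⇒InGen x balanced (inj₁ perm) = gen-perm perm
  PermOrTypeBelow⇒InGen x balanced (inj₂ (μ , P , type-x)) with InU⇒diagram x balanced | Preceq⇒InGen P
  ... | α , x~diagram | h , g , type-h =
    InGen-resp (SameKer-sym x~diagram)
      (InGen-of-same-type (↭-trans (↭-sym (typeD-InU x balanced)) (↭-trans type-x (↭-sym type-h))) g α)


  InGen⇔PermOrTypeBelow : ∀ x → InU x → InGen π x ⇔ PermOrTypeBelow x
  InGen⇔PermOrTypeBelow x balanced = mk⇔ (InGen⇒PermOrTypeBelow x balanced) (PermOrTypeBelow⇒InGen x balanced)

  InGen-eDiag⇔Preceq : ∀ γ → ¬ (typeSP γ ↭ oneK k) → InGen π (eDiag γ) ⇔ Preceq k (typeSP γ) (typeSP π)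
  InGen-eDiag⇔Preceq γ not-discrete = mk⇔ type-below e-generated
    where
    e-balanced : InU (eDiag γ)
    e-balanced _ = refl
    type-e : typeD (eDiag γ) ↭ typeSP γ
    type-e = typeD-InU (eDiag γ) e-balanced
    type-below : InGen π (eDiag γ) → Preceq k (typeSP γ) (typeSP π)
    type-below g with InGen⇒PermOrTypeBelow (eDiag γ) e-balanced g
    ... | inj₁ (σ , s) = ⊥-elim (not-discrete (typeSP-injective γ λ {a} {b} e →
                           permLabels-injective σ (to (s (inj₁ a) (inj₁ b)) e)))
    ... | inj₂ (μ , P , type-μ) = Preceq-resp (↭-trans (↭-sym type-μ) type-e) P
    e-generated : Preceq k (typeSP γ) (typeSP π) → InGen π (eDiag γ)
    e-generated P = PermOrTypeBelow⇒InGen (eDiag γ) e-balanced (inj₂ (typeSP γ , P , type-e))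

proposition5p2 : (k : ℕ) → 1 ≤ k → (π : SetPart k) →
    ((γ : SetPart k) → ¬ (typeSP γ ↭ oneK k) →
       (InGen π (eDiag γ) ⇔ Preceq k (typeSP γ) (typeSP π)))
    ×
    ((x : Diagram k) → InU x →
       (InGen π x ⇔
         (IsPerm x ⊎ Σ (List ℕ) (λ μ → Preceq k μ (typeSP π) × (typeD x ↭ μ)))))
proposition5p2 k _ π = InGen-eDiag⇔Preceq π , InGen⇔PermOrTypeBelow π
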